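{- Let $G$ be a graph of order $n$ containing a cycle $C: v_0v_1\ldots v_{n-2}v_0$ of length $n-1$, and let $u$ be the unique vertex of $G$ not on $C$. If $u$ has degree more than $\frac{n-1}{2}$, then $G$ is pancyclic, i.e., $G$ contains a cycle of every length $\ell$ with $3\leq \ell\leq n$.
   Context: All graphs are finite, simple and undirected. A graph of order $n$ is pancyclic if its set of cycle lengths is $\{3,\ldots,n\}$. -}

module Defs where

open import Data.Nat using (ℕ; suc; _≤_)
open import Data.Fin using (Fin; zero; suc; inject₁; fromℕ)
open import Data.Bool using (Bool; false; T)
open import Data.Bool.Properties using (T?)
open import Data.List using (filter; length; allFin)
open import Data.Product using (Σ; _×_)
open import Data.Empty using (⊥)
open import Relation.Binary.PropositionalEquality using (_≡_)
open import Function.Definitions using (Injective)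

record Graph (n : ℕ) : Set where
  field
    adj    : Fin n → Fin n → Bool
    sym    : ∀ x y → adj x y ≡ adj y x
    irrefl : ∀ x → adj x x ≡ false
open Graph public

Adj : ∀ {n} → Graph n → Fin n → Fin n → Set
Adj G x y = T (adj G x y)

degree : ∀ {n} → Graph n → Fin n → ℕ
degree {n} G u = length (filter (λ v → T? (adj G u v)) (allFin n))

-- A cycle of length (suc m) in G: an injective vertex sequence
-- c 0, c 1, ..., c m with consecutive vertices adjacent and c m adjacent
-- to c 0; cycles have length at least 3.
record IsCycle {n : ℕ} (G : Graph n) (m : ℕ) (c : Fin (suc m) → Fin n) : Set where
  field
    long  : 3 ≤ suc m
    inj   : Injective _≡_ _≡_ c
    steps : ∀ (i : Fin m) → Adj G (c (inject₁ i)) (c (suc i))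
    close : Adj G (c (fromℕ m)) (c zero)

HasCycle : ∀ {n} → Graph n → ℕ → Set
HasCycle G 0 = ⊥
HasCycle G (suc m) = Σ (Fin (suc m) → Fin _) (IsCycle G m)

Pancyclic : ∀ {n} → Graph n → Set
Pancyclic {n} G = ∀ ℓ → 3 ≤ ℓ → ℓ ≤ n → HasCycle G ℓ

module Submission where

open import Defs hiding (sym)
open import Data.Nat using (ℕ; suc; _+_; _*_; _∸_; _%_; _<_; _≤_; _<?_; s≤s; NonZero)
open import Data.Nat.Properties
  using (+-assoc; +-comm; +-identityʳ; +-suc; ≤-trans; ≤-antisym; ≤-pred; ≮⇒≥; n≮n; m≤n⇒m≤1+n; m∸n+n≡m; m+[n∸m]≡n)
open import Data.Nat.DivMod
  using (_/_; _mod_; m≡m%n+[m/n]*n; %-distribˡ-+; m%n%n≡m%n; [m+n]%n≡m%n; [m+kn]%n≡m%n; m%n<n; m%n≤n; m<n⇒m%n≡m; n%n≡0)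
open import Data.Fin using (Fin; zero; suc; toℕ; inject₁; fromℕ; fromℕ<; splitAt; join; punchOut)
open import Data.Fin.Properties
  using (toℕ-injective; toℕ-fromℕ<; toℕ-fromℕ; toℕ-inject₁; toℕ<n; _≟_; any?; pigeonhole; injective⇒≤; punchOut-injective; join-splitAt; <⇒≢)
open import Data.Bool using (T)
open import Data.Bool.Properties using (T?)
open import Data.List using (List; filter; allFin; lookup)
open import Data.List.Relation.Unary.AllPairs using (_∷_)
open import Data.List.Relation.Unary.All as All using ()
open import Data.List.Relation.Unary.Unique.Propositional using (Unique)
open import Data.List.Relation.Unary.Unique.Propositional.Properties using (allFin⁺; filter⁺)
open import Data.List.Membership.Propositional.Properties using (∈-filter⁻; ∈-lookup)
open import Data.Product using (_,_; proj₁; proj₂; ∃; ∃₂; map₂)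
open import Data.Sum using (inj₁; inj₂; [_,_]′)
open import Function using (_∘_)
open import Function.Definitions using (Injective)
open import Relation.Nullary using (yes; no; contradiction)
open import Relation.Binary.PropositionalEquality
  using (_≡_; _≢_; refl; sym; trans; cong; subst; subst₂; module ≡-Reasoning)

open ≡-Reasoning

-- Index C by ℤ/(n-1). The positions of the neighbours of u fill more than
-- half of ℤ/(n-1), so for every shift s they meet their own translate by -s:
-- u is adjacent to both c_i and c_{i+s}, and u c_i c_{i+1} … c_{i+s} u is a
-- cycle of length s + 2. The shifts 1, …, n - 2 give all lengths 3, …, n.

toℕ-mod : ∀ m n .{{_ : NonZero n}} → toℕ (m mod n) ≡ m % n
toℕ-mod m n = toℕ-fromℕ< (m%n<n m n)

[m%n+o]%n≡[m+o]%n : ∀ m o n .{{_ : NonZero n}} → (m % n + o) % n ≡ (m + o) % n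
[m%n+o]%n≡[m+o]%n m o n = begin
  (m % n + o) % n          ≡⟨ %-distribˡ-+ (m % n) o n ⟩
  (m % n % n + o % n) % n  ≡⟨ cong (λ x → (x + o % n) % n) (m%n%n≡m%n m n) ⟩
  (m % n + o % n) % n      ≡⟨ %-distribˡ-+ m o n ⟨
  (m + o) % n              ∎

[1+m%n]%n≡[1+m]%n : ∀ m n .{{_ : NonZero n}} → suc (m % n) % n ≡ suc m % n
[1+m%n]%n≡[1+m]%n m n = begin
  suc (m % n) % n  ≡⟨ cong (_% n) (+-comm 1 (m % n)) ⟩
  (m % n + 1) % n  ≡⟨ [m%n+o]%n≡[m+o]%n m 1 n ⟩
  (m + 1) % n      ≡⟨ cong (_% n) (+-comm m 1) ⟩
  suc m % n        ∎

m+[n∸m%n]≡[1+m/n]*n : ∀ m n .{{_ : NonZero n}} → m + (n ∸ m % n) ≡ suc (m / n) * n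
m+[n∸m%n]≡[1+m/n]*n m n = begin
  m + (n ∸ m % n)                    ≡⟨ cong (_+ (n ∸ m % n)) (m≡m%n+[m/n]*n m n) ⟩
  m % n + m / n * n + (n ∸ m % n)    ≡⟨ cong (_+ (n ∸ m % n)) (+-comm (m % n) (m / n * n)) ⟩
  m / n * n + m % n + (n ∸ m % n)    ≡⟨ +-assoc (m / n * n) (m % n) (n ∸ m % n) ⟩
  m / n * n + (m % n + (n ∸ m % n))  ≡⟨ cong (m / n * n +_) (m+[n∸m]≡n (m%n≤n m n)) ⟩
  m / n * n + n                      ≡⟨ +-comm (m / n * n) n ⟩
  suc (m / n) * n                    ∎

-- Adding n ∸ m % n undoes the translation by m modulo n.
+-cancelˡ-% : ∀ m {o p} n .{{_ : NonZero n}} → o < n → p < n → (m + o) % n ≡ (m + p) % n → o ≡ p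
+-cancelˡ-% m {o} {p} n o<n p<n eq = begin
  o                                ≡⟨ m<n⇒m%n≡m o<n ⟨
  o % n                            ≡⟨ untranslate o ⟨
  ((m + o) % n + (n ∸ m % n)) % n  ≡⟨ cong (λ x → (x + (n ∸ m % n)) % n) eq ⟩
  ((m + p) % n + (n ∸ m % n)) % n  ≡⟨ untranslate p ⟩
  p % n                            ≡⟨ m<n⇒m%n≡m p<n ⟩
  p                                ∎
  where
  untranslate : ∀ o → ((m + o) % n + (n ∸ m % n)) % n ≡ o % n
  untranslate o = begin
    ((m + o) % n + (n ∸ m % n)) % n  ≡⟨ [m%n+o]%n≡[m+o]%n (m + o) (n ∸ m % n) n ⟩
    (m + o + (n ∸ m % n)) % n        ≡⟨ cong (λ x → (x + (n ∸ m % n)) % n) (+-comm m o) ⟩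
    (o + m + (n ∸ m % n)) % n        ≡⟨ cong (_% n) (+-assoc o m (n ∸ m % n)) ⟩
    (o + (m + (n ∸ m % n))) % n      ≡⟨ cong (λ x → (o + x) % n) (m+[n∸m%n]≡[1+m/n]*n m n) ⟩
    (o + suc (m / n) * n) % n        ≡⟨ [m+kn]%n≡m%n o (suc (m / n)) n ⟩
    o % n                            ∎

Unique⇒lookup-injective : ∀ {A : Set} {xs : List A} → Unique xs → Injective _≡_ _≡_ (lookup xs)
Unique⇒lookup-injective (_ ∷ _)    {zero}  {zero}  _  = refl
Unique⇒lookup-injective (x∉ ∷ _)   {zero}  {suc j} eq = contradiction eq (All.lookup x∉ (∈-lookup j))
Unique⇒lookup-injective (x∉ ∷ _)   {suc i} {zero}  eq = contradiction (sym eq) (All.lookup x∉ (∈-lookup i))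
Unique⇒lookup-injective (_ ∷ uniq) {suc i} {suc j} eq = cong suc (Unique⇒lookup-injective uniq eq)

-- Otherwise v would extend f to an injection Fin (suc m) → Fin (suc m) ∖ {u}.
injective⇒hits-all-but : ∀ {m} {f : Fin m → Fin (suc m)} {u} → Injective _≡_ _≡_ f →
                         (∀ i → f i ≢ u) → ∀ v → v ≢ u → ∃ λ i → f i ≡ v
injective⇒hits-all-but {m} {f} {u} f-inj f≢u v v≢u with any? (λ i → f i ≟ v)
... | yes hit = hit
... | no miss = contradiction (injective⇒≤ extend-injective) (n≮n m)
  where
  extend : Fin (suc m) → Fin m
  extend zero    = punchOut (v≢u ∘ sym)
  extend (suc i) = punchOut (f≢u i ∘ sym)

  extend-injective : Injective _≡_ _≡_ extend
  extend-injective {zero}  {zero}  _  = refl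
  extend-injective {zero}  {suc j} eq = contradiction (j , sym (punchOut-injective (v≢u ∘ sym) (f≢u j ∘ sym) eq)) miss
  extend-injective {suc i} {zero}  eq = contradiction (i , punchOut-injective (f≢u i ∘ sym) (v≢u ∘ sym) eq) miss
  extend-injective {suc i} {suc j} eq = cong suc (f-inj (punchOut-injective (f≢u i ∘ sym) (f≢u j ∘ sym) eq))

injective-images-meet : ∀ {a b n} {f : Fin a → Fin n} {g : Fin b → Fin n} →
                        Injective _≡_ _≡_ f → Injective _≡_ _≡_ g → n < a + b → ∃₂ λ i j → f i ≡ g j
injective-images-meet {a} {b} {f = f} {g} f-inj g-inj n<a+b with pigeonhole n<a+b ([ f , g ]′ ∘ splitAt a)
... | x , y , x<y , eq = collide (splitAt a x) (splitAt a y) (<⇒≢ x<y ∘ splitAt-injective) eq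
  where
  splitAt-injective : ∀ {x y} → splitAt a x ≡ splitAt a y → x ≡ y
  splitAt-injective {x} {y} eq = begin
    x                       ≡⟨ join-splitAt a b x ⟨
    join a b (splitAt a x)  ≡⟨ cong (join a b) eq ⟩
    join a b (splitAt a y)  ≡⟨ join-splitAt a b y ⟩
    y                       ∎

  collide : ∀ p q → p ≢ q → [ f , g ]′ p ≡ [ f , g ]′ q → ∃₂ λ i j → f i ≡ g j
  collide (inj₁ i) (inj₁ j) p≢q eq = contradiction (cong inj₁ (f-inj eq)) p≢q
  collide (inj₁ i) (inj₂ j) _   eq = i , j , eq
  collide (inj₂ i) (inj₁ j) _   eq = j , i , sym eq
  collide (inj₂ i) (inj₂ j) p≢q eq = contradiction (cong inj₂ (g-inj eq)) p≢q

dense-meets-translate : ∀ {d n} .{{_ : NonZero n}} {f : Fin d → Fin n} → Injective _≡_ _≡_ f →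
                        n < d + d → ∀ {s} → s ≤ n → ∃₂ λ i j → (toℕ (f i) + s) % n ≡ toℕ (f j)
dense-meets-translate {d} {n} {f} f-inj n<d+d {s} s≤n =
  map₂ (map₂ shift-back) (injective-images-meet f-inj translate-injective n<d+d)
  where
  translate : Fin d → Fin n
  translate j = ((n ∸ s) + toℕ (f j)) mod n

  translate-injective : Injective _≡_ _≡_ translate
  translate-injective {i} {j} eq = f-inj (toℕ-injective (+-cancelˡ-% (n ∸ s) n (toℕ<n (f i)) (toℕ<n (f j))
    (trans (sym (toℕ-mod _ n)) (trans (cong toℕ eq) (toℕ-mod _ n)))))

  shift-back : ∀ {i j} → f i ≡ translate j → (toℕ (f i) + s) % n ≡ toℕ (f j)
  shift-back {i} {j} eq = begin
    (toℕ (f i) + s) % n                  ≡⟨ cong (λ x → (toℕ x + s) % n) eq ⟩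
    (toℕ (translate j) + s) % n          ≡⟨ cong (λ x → (x + s) % n) (toℕ-mod _ n) ⟩
    (((n ∸ s) + toℕ (f j)) % n + s) % n  ≡⟨ [m%n+o]%n≡[m+o]%n ((n ∸ s) + toℕ (f j)) s n ⟩
    ((n ∸ s) + toℕ (f j) + s) % n        ≡⟨ cong (λ x → (x + s) % n) (+-comm (n ∸ s) (toℕ (f j))) ⟩
    (toℕ (f j) + (n ∸ s) + s) % n        ≡⟨ cong (_% n) (+-assoc (toℕ (f j)) (n ∸ s) s) ⟩
    (toℕ (f j) + ((n ∸ s) + s)) % n      ≡⟨ cong (λ x → (toℕ (f j) + x) % n) (m∸n+n≡m s≤n) ⟩
    (toℕ (f j) + n) % n                  ≡⟨ [m+n]%n≡m%n (toℕ (f j)) n ⟩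
    toℕ (f j) % n                        ≡⟨ m<n⇒m%n≡m (toℕ<n (f j)) ⟩
    toℕ (f j)                            ∎

Adj-sym : ∀ {n} (G : Graph n) {x y} → Adj G x y → Adj G y x
Adj-sym G {x} {y} = subst T (Graph.sym G x y)

neighbours : ∀ {n} → Graph n → Fin n → List (Fin n)
neighbours {n} G u = filter (λ v → T? (adj G u v)) (allFin n)

neighbour : ∀ {n} (G : Graph n) u → Fin (degree G u) → Fin n
neighbour G u = lookup (neighbours G u)

neighbour-adjacent : ∀ {n} (G : Graph n) u x → Adj G u (neighbour G u x)
neighbour-adjacent {n} G u x = proj₂ (∈-filter⁻ (λ v → T? (adj G u v)) {xs = allFin n} (∈-lookup x))

neighbour-injective : ∀ {n} (G : Graph n) u → Injective _≡_ _≡_ (neighbour G u)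
neighbour-injective {n} G u = Unique⇒lookup-injective (filter⁺ (λ v → T? (adj G u v)) (allFin⁺ n))

neighbour≢self : ∀ {n} (G : Graph n) u x → neighbour G u x ≢ u
neighbour≢self G u x eq = subst T (Graph.irrefl G u) (subst (Adj G u) eq (neighbour-adjacent G u x))

-- When c and u together exhaust the vertices, every neighbour of u lies on c.
module _ {k} (G : Graph (suc (suc k))) {c : Fin (suc k) → Fin (suc (suc k))} (c-inj : Injective _≡_ _≡_ c)
         {u} (u∉c : ∀ i → c i ≢ u) where

  neighbourPosition : Fin (degree G u) → Fin (suc k)
  neighbourPosition x = proj₁ (injective⇒hits-all-but c-inj u∉c (neighbour G u x) (neighbour≢self G u x))

  c∘neighbourPosition : ∀ x → c (neighbourPosition x) ≡ neighbour G u x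
  c∘neighbourPosition x = proj₂ (injective⇒hits-all-but c-inj u∉c (neighbour G u x) (neighbour≢self G u x))

  neighbourPosition-injective : Injective _≡_ _≡_ neighbourPosition
  neighbourPosition-injective {x} {y} eq = neighbour-injective G u (begin
    neighbour G u x          ≡⟨ c∘neighbourPosition x ⟨
    c (neighbourPosition x)  ≡⟨ cong c eq ⟩
    c (neighbourPosition y)  ≡⟨ c∘neighbourPosition y ⟩
    neighbour G u y          ∎)

  neighbourPosition-adjacent : ∀ x → Adj G u (c (neighbourPosition x))
  neighbourPosition-adjacent x = subst (Adj G u) (sym (c∘neighbourPosition x)) (neighbour-adjacent G u x)

module CycleWalk {n} {G : Graph n} {k} {c : Fin (suc k) → Fin n} (C : IsCycle G k c) where
  open IsCycle C

  vertexAt : ℕ → Fin n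
  vertexAt j = c (j mod suc k)

  vertexAt-≡ : ∀ j {i} → j % suc k ≡ toℕ i → vertexAt j ≡ c i
  vertexAt-≡ j eq = cong c (toℕ-injective (trans (toℕ-mod j (suc k)) eq))

  vertexAt-adjacent : ∀ j → Adj G (vertexAt j) (vertexAt (suc j))
  vertexAt-adjacent j with j % suc k <? k
  ... | yes r<k = subst₂ (Adj G) (sym (vertexAt-≡ j here)) (sym (vertexAt-≡ (suc j) next)) (steps (fromℕ< r<k))
    where
    here : j % suc k ≡ toℕ (inject₁ (fromℕ< r<k))
    here = sym (trans (toℕ-inject₁ (fromℕ< r<k)) (toℕ-fromℕ< r<k))

    next : suc j % suc k ≡ suc (toℕ (fromℕ< r<k))
    next = begin
      suc j % suc k            ≡⟨ [1+m%n]%n≡[1+m]%n j (suc k) ⟨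
      suc (j % suc k) % suc k  ≡⟨ m<n⇒m%n≡m (s≤s r<k) ⟩
      suc (j % suc k)          ≡⟨ cong suc (toℕ-fromℕ< r<k) ⟨
      suc (toℕ (fromℕ< r<k))   ∎
  ... | no r≮k = subst₂ (Adj G) (sym (vertexAt-≡ j here)) (sym (vertexAt-≡ (suc j) next)) close
    where
    r≡k : j % suc k ≡ k
    r≡k = ≤-antisym (≤-pred (m%n<n j (suc k))) (≮⇒≥ r≮k)

    here : j % suc k ≡ toℕ (fromℕ k)
    here = trans r≡k (sym (toℕ-fromℕ k))

    next : suc j % suc k ≡ 0
    next = begin
      suc j % suc k            ≡⟨ [1+m%n]%n≡[1+m]%n j (suc k) ⟨
      suc (j % suc k) % suc k  ≡⟨ cong (λ r → suc r % suc k) r≡k ⟩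
      suc k % suc k            ≡⟨ n%n≡0 (suc k) ⟩
      0                        ∎

  vertexAt-injective : ∀ i {a b} → a < suc k → b < suc k → vertexAt (i + a) ≡ vertexAt (i + b) → a ≡ b
  vertexAt-injective i {a} {b} a<k+1 b<k+1 eq = +-cancelˡ-% i (suc k) a<k+1 b<k+1
    (trans (sym (toℕ-mod (i + a) (suc k))) (trans (cong toℕ (inj eq)) (toℕ-mod (i + b) (suc k))))

  cycle-through : ∀ {u} → (∀ i → c i ≢ u) → ∀ {s} → 1 ≤ s → s < suc k →
                  ∀ i → Adj G u (vertexAt i) → Adj G u (vertexAt (i + s)) → HasCycle G (suc (suc s))
  cycle-through {u} u∉C {s} 1≤s s<k+1 i u~cᵢ u~cᵢ₊ₛ =
    cyc , record { long = s≤s (s≤s 1≤s) ; inj = cyc-injective ; steps = cyc-steps ; close = cyc-close }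
    where
    cyc : Fin (suc (suc s)) → Fin n
    cyc zero    = u
    cyc (suc p) = vertexAt (i + toℕ p)

    bound : (p : Fin (suc s)) → toℕ p < suc k
    bound p = ≤-trans (toℕ<n p) s<k+1

    cyc-injective : Injective _≡_ _≡_ cyc
    cyc-injective {zero}  {zero}  _  = refl
    cyc-injective {zero}  {suc q} eq = contradiction (sym eq) (u∉C _)
    cyc-injective {suc p} {zero}  eq = contradiction eq (u∉C _)
    cyc-injective {suc p} {suc q} eq = cong suc (toℕ-injective (vertexAt-injective i (bound p) (bound q) eq))

    cyc-steps : ∀ (p : Fin (suc s)) → Adj G (cyc (inject₁ p)) (cyc (suc p))
    cyc-steps zero    = subst (Adj G u ∘ vertexAt) (sym (+-identityʳ i)) u~cᵢ
    cyc-steps (suc p) = subst₂ (λ a b → Adj G (vertexAt a) (vertexAt b))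
      (cong (i +_) (sym (toℕ-inject₁ p))) (sym (+-suc i (toℕ p))) (vertexAt-adjacent (i + toℕ p))

    cyc-close : Adj G (cyc (fromℕ (suc s))) (cyc zero)
    cyc-close = subst (λ a → Adj G (vertexAt (i + a)) u) (sym (toℕ-fromℕ s)) (Adj-sym G u~cᵢ₊ₛ)

lemma1 : (m : ℕ) (G : Graph (suc m)) (k : ℕ) (c : Fin (suc k) → Fin (suc m))
    → suc k ≡ m
    → IsCycle G k c
    → (u : Fin (suc m))
    → (∀ i → c i ≢ u)
    → m < 2 * degree G u
    → Pancyclic G
lemma1 .(suc k) G k c refl C u u∉C k+1<2d (suc (suc s)) (s≤s (s≤s 1≤s)) (s≤s (s≤s s≤k)) =
  let i , j , i+s≡j = dense-meets-translate (neighbourPosition-injective G inj u∉C) k+1<d+d (m≤n⇒m≤1+n s≤k)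
  in cycle-through u∉C 1≤s (s≤s s≤k) (toℕ (position i))
       (adjacentAt (toℕ (position i)) (m<n⇒m%n≡m (toℕ<n (position i))))
       (adjacentAt (toℕ (position i) + s) i+s≡j)
  where
  open IsCycle C
  open CycleWalk C

  position : Fin (degree G u) → Fin (suc k)
  position = neighbourPosition G inj u∉C

  adjacentAt : ∀ p {x} → p % suc k ≡ toℕ (position x) → Adj G u (vertexAt p)
  adjacentAt p {x} eq = subst (Adj G u) (sym (vertexAt-≡ p eq)) (neighbourPosition-adjacent G inj u∉C x)

  k+1<d+d : suc k < degree G u + degree G u
  k+1<d+d = subst (suc k <_) (cong (degree G u +_) (+-identityʳ (degree G u))) k+1<2d
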